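{- Let $r$ be a positive integer and let $F:\mathbf{Set}^r\to\mathbf{Set}$ be a decomposable $r$-sort species with composition operator $\eta$. Then $|F[\boldsymbol\emptyset]|=1$, where $\boldsymbol\emptyset=(\emptyset,\dots,\emptyset)$.
   Context: $\mathbf{Set}$ is the category of finite sets and bijections. Objects of $\mathbf{Set}^r$ are $r$-tuples of finite sets, and set operations on them are componentwise. An $r$-sort species is a functor $F:\mathbf{Set}^r\to\mathbf{Set}$. A composition operator for $F$ is a family of injective maps $\eta_{(\Omega_1,\Omega_2)}:F[\Omega_1]\times F[\Omega_2]\to F[\Omega_1\amalg\Omega_2]$, one for each pair with $\Omega_1\cap\Omega_2=\boldsymbol\emptyset$, with the following two properties. - Naturality: $\eta_{(\tilde\Omega_1,\tilde\Omega_2)}\circ(F[f_1]\times F[f_2])=F[f_1\amalg f_2]\circ\eta_{(\Omega_1,\Omega_2)}$ for tuples of bijections $f_i:\Omega_i\to\tilde\Omega_i$. - Axiom (D1): whenever $\Omega_1\amalg\Omega_2=\Omega=\tilde\Omega_1\amalg\tilde\Omega_2$, \[ \eta(F[\Omega_1]\times F[\Omega_2])\cap\eta(F[\tilde\Omega_1]\times F[\tilde\Omega_2])=\eta(\eta(F[\Omega_{11}]\times F[\Omega_{12}])\times\eta(F[\Omega_{21}]\times F[\Omega_{22}])), \] where $\Omega_{ij}=\Omega_i\cap\tilde\Omega_j$ and $\eta(A\times B)$ denotes the image under the relevant $\eta$-map. $F$ is decomposable if $F[\Omega]\neq\emptyset$ for some $\Omega$ and $F$ admits a composition operator. -}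

module Defs where

open import Data.Nat using (ℕ; _≤_)
open import Data.Bool using (Bool; true; false; T; _∧_; _∨_)
open import Data.Fin using (Fin)
open import Data.Product using (Σ; ∃; _×_; _,_; proj₁)
open import Relation.Binary.PropositionalEquality using (_≡_)
open import Function.Bundles using (_↔_; Inverse)
open import Function.Construct.Identity using (↔-id)
open import Function.Construct.Composition using (_↔-∘_)

-- Finite sets: finite subsets of the label set ℕ, given by a decidable
-- (Bool-valued) membership predicate together with a bound.

record FinSet : Set where
  field
    mem    : ℕ → Bool
    bound  : ℕ
    finite : ∀ x → bound ≤ x → mem x ≡ false
open FinSet public

El : FinSet → Set
El A = Σ ℕ (λ x → T (mem A x))

∅set : FinSet
∅set = record { mem = λ _ → false ; bound = 0 ; finite = λ _ _ → _≡_.refl }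

Obj : ℕ → Set
Obj r = Fin r → FinSet

∅obj : (r : ℕ) → Obj r
∅obj r = λ _ → ∅set

record Bij {r : ℕ} (Ω Ω' : Obj r) : Set where
  constructor mkBij
  field
    comp : ∀ i → El (Ω i) ↔ El (Ω' i)
open Bij public

idB : {r : ℕ} (Ω : Obj r) → Bij Ω Ω
idB Ω = mkBij (λ i → ↔-id (El (Ω i)))

_∘B_ : {r : ℕ} {Ω Ω' Ω'' : Obj r} → Bij Ω' Ω'' → Bij Ω Ω' → Bij Ω Ω''
g ∘B f = mkBij (λ i → comp g i ↔-∘ comp f i)

_≈B_ : {r : ℕ} {Ω Ω' : Obj r} → Bij Ω Ω' → Bij Ω Ω' → Set
f ≈B g = ∀ i x → Inverse.to (comp f i) x ≡ Inverse.to (comp g i) x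

IsFinite : Set → Set
IsFinite A = Σ ℕ (λ n → Fin n ↔ A)

record Species (r : ℕ) : Set₁ where
  field
    F       : Obj r → Set
    F-fin   : ∀ Ω → IsFinite (F Ω)
    F-map   : {Ω Ω' : Obj r} → Bij Ω Ω' → F Ω → F Ω'
    F-cong  : {Ω Ω' : Obj r} (f g : Bij Ω Ω') → f ≈B g → ∀ z → F-map f z ≡ F-map g z
    F-id    : (Ω : Obj r) → ∀ z → F-map (idB Ω) z ≡ z
    F-comp  : {Ω Ω' Ω'' : Obj r} (f : Bij Ω Ω') (g : Bij Ω' Ω'') →
              ∀ z → F-map (g ∘B f) z ≡ F-map g (F-map f z)
open Species public

record IsDisjUnion {r : ℕ} (Ω₁ Ω₂ Ω : Obj r) : Set where
  field
    disjoint : ∀ i x → mem (Ω₁ i) x ∧ mem (Ω₂ i) x ≡ false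
    union    : ∀ i x → mem (Ω i) x ≡ mem (Ω₁ i) x ∨ mem (Ω₂ i) x

IsInter : {r : ℕ} → Obj r → Obj r → Obj r → Set
IsInter Ω₁ Ω₂ Ω = ∀ i x → mem (Ω i) x ≡ mem (Ω₁ i) x ∧ mem (Ω₂ i) x

-- f restricted to the subobject Ω₁ of Ω agrees (on labels) with f₁
Restricts : {r : ℕ} {Ω₁ Ω₁' Ω Ω' : Obj r} → Bij Ω Ω' → Bij Ω₁ Ω₁' → Set
Restricts {r} {Ω₁} {Ω₁'} {Ω} {Ω'} f f₁ =
  ∀ i x (p : T (mem (Ω i) x)) (q : T (mem (Ω₁ i) x)) →
    proj₁ (Inverse.to (comp f i) (x , p)) ≡ proj₁ (Inverse.to (comp f₁ i) (x , q))

EtaType : {r : ℕ} → Species r → Set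
EtaType {r} S = {Ω₁ Ω₂ Ω : Obj r} → IsDisjUnion Ω₁ Ω₂ Ω → F S Ω₁ → F S Ω₂ → F S Ω

InImage : {r : ℕ} (S : Species r) (η : EtaType S) {Ω₁ Ω₂ Ω : Obj r} →
          IsDisjUnion Ω₁ Ω₂ Ω → F S Ω → Set
InImage S η {Ω₁} {Ω₂} d z = Σ (F S Ω₁) (λ a → Σ (F S Ω₂) (λ b → η d a b ≡ z))

record IsCompositionOperator {r : ℕ} (S : Species r) (η : EtaType S) : Set where
  field
    injective : {Ω₁ Ω₂ Ω : Obj r} (d : IsDisjUnion Ω₁ Ω₂ Ω) →
                ∀ a b a' b' → η d a b ≡ η d a' b' → (a ≡ a') × (b ≡ b')
    -- naturality: η ∘ (F[f₁] × F[f₂]) = F[f₁ ∐ f₂] ∘ η,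
    -- where f : Ω → Ω' is the bijection f₁ ∐ f₂
    natural   : {Ω₁ Ω₂ Ω Ω₁' Ω₂' Ω' : Obj r}
                (d : IsDisjUnion Ω₁ Ω₂ Ω) (d' : IsDisjUnion Ω₁' Ω₂' Ω')
                (f₁ : Bij Ω₁ Ω₁') (f₂ : Bij Ω₂ Ω₂') (f : Bij Ω Ω') →
                Restricts f f₁ → Restricts f f₂ →
                ∀ a b → η d' (F-map S f₁ a) (F-map S f₂ b) ≡ F-map S f (η d a b)
    D1        : {Ω Ω₁ Ω₂ Ω₁' Ω₂' Ω₁₁ Ω₁₂ Ω₂₁ Ω₂₂ : Obj r}
                (d : IsDisjUnion Ω₁ Ω₂ Ω) (d' : IsDisjUnion Ω₁' Ω₂' Ω) →
                IsInter Ω₁ Ω₁' Ω₁₁ → IsInter Ω₁ Ω₂' Ω₁₂ →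
                IsInter Ω₂ Ω₁' Ω₂₁ → IsInter Ω₂ Ω₂' Ω₂₂ →
                (d₁ : IsDisjUnion Ω₁₁ Ω₁₂ Ω₁) (d₂ : IsDisjUnion Ω₂₁ Ω₂₂ Ω₂) →
                (z : F S Ω) →
                ((InImage S η d z × InImage S η d' z) →
                   Σ (F S Ω₁₁) λ a → Σ (F S Ω₁₂) λ b → Σ (F S Ω₂₁) λ c → Σ (F S Ω₂₂) λ e →
                     η d (η d₁ a b) (η d₂ c e) ≡ z)
                × ((Σ (F S Ω₁₁) λ a → Σ (F S Ω₁₂) λ b → Σ (F S Ω₂₁) λ c → Σ (F S Ω₂₂) λ e →
                     η d (η d₁ a b) (η d₂ c e) ≡ z) →
                   InImage S η d z × InImage S η d' z)

module Submission where

-- (1) F[∅] is inhabited.  If η_{(Ω₁,Ω₂)} has some value z, apply axiom (D1)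
--     to the decomposition Ω₁ ∐ Ω₂ and itself: the intersections Ω₁ ∩ Ω₂ and
--     Ω₂ ∩ Ω₁ are ∅, so z factors through η(F[Ω₁] × F[∅]) and yields an
--     element of F[∅].  A value of η exists because every finite set has a
--     disjoint copy (shift its labels past its bound): from z ∈ F[Ω] we get
--     z' ∈ F[Ω'] for a disjoint copy Ω' of Ω, and η(z, z') is such a value.
--
-- (2) F[∅] has at most one element.  Since ∅ ∐ ∅ = ∅, η gives an injective
--     binary operation on the finite set F[∅].  On a finite set A such an
--     operation forces any two elements a, b to be equal: otherwise
--     x ↦ a·x and x ↦ b·x would combine to an injection A ⊎ A ↣ A, impossible
--     for a nonempty finite A by counting.

open import Defs
open import Data.Nat using (ℕ; NonZero; zero; suc; _+_; _≤_; _<_; _≤?_; s≤s)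
open import Data.Nat.Properties using (≰⇒>; ≤-trans; m≤m+n; m≤n+m; 1+n≰n)
open import Data.Fin using (Fin)
open import Data.Fin.Properties using (injective⇒≤; +↔⊎; inj⇒≟)
open import Data.Bool using (Bool; false; T; _∧_; _∨_)
open import Data.Bool.Properties using (∧-idem; ∧-comm; ∧-zeroʳ; ∨-identityʳ)
open import Data.Product using (Σ; _×_; _,_; proj₁; proj₂)
open import Data.Sum using (_⊎_; inj₁; inj₂; [_,_])
open import Data.Sum.Function.Propositional using (_⊎-↔_)
open import Data.Empty using (⊥; ⊥-elim)
open import Relation.Nullary using (¬_; yes; no)
open import Relation.Binary.PropositionalEquality using (_≡_; refl; sym; trans; cong)
open import Function.Bundles using (_↔_; _↣_; Inverse; Injection; mk↣; mk↔ₛ′)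
open import Function.Construct.Composition using (_↔-∘_; _↣-∘_)
open import Function.Construct.Symmetry using (↔-sym)
open import Function.Properties.Inverse using (↔⇒↣)

-- A nonempty finite type cannot absorb two copies of itself injectively:
-- with |A| = n this would give an injection Fin (n + n) ↣ Fin n.
no-doubling : {A : Set} → IsFinite A → (A ⊎ A) ↣ A → ¬ A
no-doubling {A} (n , e) g a = impossible n (Inverse.from e a) n+n≤n
  where
  finDoubling : Fin (n + n) ↣ Fin n
  finDoubling = ↔⇒↣ (↔-sym e) ↣-∘ (g ↣-∘ ↔⇒↣ ((e ⊎-↔ e) ↔-∘ +↔⊎))

  n+n≤n : n + n ≤ n
  n+n≤n = injective⇒≤ (Injection.injective finDoubling)

  impossible : ∀ k → Fin k → k + k ≤ k → ⊥
  impossible (suc k) _ (s≤s l) = 1+n≰n (≤-trans (m≤n+m (suc k) k) l)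

JointlyInjective : {A : Set} → (A → A → A) → Set
JointlyInjective {A} _·_ = ∀ a b a' b' → a · b ≡ a' · b' → (a ≡ a') × (b ≡ b')

-- A finite type carrying a jointly injective operation has at most one
-- element: for a ≢ b, the maps a ·_ and b ·_ have disjoint images.
finite-injective-op⇒subsingleton : {A : Set} → IsFinite A → (_·_ : A → A → A) →
  JointlyInjective _·_ → ∀ (a b : A) → a ≡ b
finite-injective-op⇒subsingleton {A} (n , e) _·_ ·-inj a b
  with inj⇒≟ (↔⇒↣ (↔-sym e)) a b
... | yes a≡b = a≡b
... | no a≢b = ⊥-elim (no-doubling (n , e) (mk↣ translations-injective) a)
  where
  translations : A ⊎ A → A
  translations = [ (a ·_) , (b ·_) ]

  translations-injective : ∀ {u v} → translations u ≡ translations v → u ≡ v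
  translations-injective {inj₁ x} {inj₁ y} p = cong inj₁ (proj₂ (·-inj _ _ _ _ p))
  translations-injective {inj₂ x} {inj₂ y} p = cong inj₂ (proj₂ (·-inj _ _ _ _ p))
  translations-injective {inj₁ x} {inj₂ y} p = ⊥-elim (a≢b (proj₁ (·-inj _ _ _ _ p)))
  translations-injective {inj₂ x} {inj₁ y} p = ⊥-elim (a≢b (sym (proj₁ (·-inj _ _ _ _ p))))

inhabited-subsingleton↔Fin1 : {A : Set} → A → (∀ (a b : A) → a ≡ b) → A ↔ Fin 1
inhabited-subsingleton↔Fin1 a all-equal =
  mk↔ₛ′ (λ _ → Fin.zero) (λ _ → a) (λ { Fin.zero → refl ; (Fin.suc ()) }) (all-equal a)

-- shiftMem b m is the membership predicate m translated by b: x ∈ m ⇔ b + x ∈ shiftMem b m.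
shiftMem : ℕ → (ℕ → Bool) → ℕ → Bool
shiftMem zero    m x       = m x
shiftMem (suc b) m zero    = false
shiftMem (suc b) m (suc x) = shiftMem b m x

shift-in : ∀ b m x → T (m x) → T (shiftMem b m (b + x))
shift-in zero    m x p = p
shift-in (suc b) m x p = shift-in b m x p

unshift : ∀ b m y → T (shiftMem b m y) → Σ ℕ (λ x → T (m x))
unshift zero    m y       q = y , q
unshift (suc b) m (suc y) q = unshift b m y q

unshift-shift : ∀ b m x p → unshift b m (b + x) (shift-in b m x p) ≡ (x , p)
unshift-shift zero    m x p = refl
unshift-shift (suc b) m x p = unshift-shift b m x p

shift-unshift : ∀ b m y q →
  _≡_ {A = Σ ℕ (λ y → T (shiftMem b m y))}
      (b + proj₁ (unshift b m y q) , shift-in b m _ (proj₂ (unshift b m y q))) (y , q)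
shift-unshift zero    m y       q = refl
shift-unshift (suc b) m (suc y) q = cong (λ { (n , p) → (suc n , p) }) (shift-unshift b m y q)

shiftMem-below : ∀ b m x → x < b → shiftMem b m x ≡ false
shiftMem-below (suc b) m zero    _       = refl
shiftMem-below (suc b) m (suc x) (s≤s l) = shiftMem-below b m x l

shiftMem-bounded : ∀ b c m → (∀ x → c ≤ x → m x ≡ false) →
  ∀ x → b + c ≤ x → shiftMem b m x ≡ false
shiftMem-bounded zero    c m f x       l       = f x l
shiftMem-bounded (suc b) c m f (suc x) (s≤s l) = shiftMem-bounded b c m f x l

-- The copy of A translated past its bound, hence disjoint from A.
copy : FinSet → FinSet
copy A = record
  { mem    = shiftMem (bound A) (mem A)
  ; bound  = bound A + bound A
  ; finite = shiftMem-bounded (bound A) (bound A) (mem A) (finite A) }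

copy↔ : (A : FinSet) → El A ↔ El (copy A)
copy↔ A = mk↔ₛ′ (λ { (x , p) → bound A + x , shift-in (bound A) (mem A) x p })
                (λ { (y , q) → unshift (bound A) (mem A) y q })
                (λ { (y , q) → shift-unshift (bound A) (mem A) y q })
                (λ { (x , p) → unshift-shift (bound A) (mem A) x p })

copy-disjoint : (A : FinSet) → ∀ x → mem A x ∧ mem (copy A) x ≡ false
copy-disjoint A x with bound A ≤? x
... | yes b≤x rewrite finite A x b≤x = refl
... | no  b≰x rewrite shiftMem-below (bound A) (mem A) x (≰⇒> b≰x) = ∧-zeroʳ (mem A x)

withCopy : FinSet → FinSet
withCopy A = record
  { mem    = λ x → mem A x ∨ mem (copy A) x
  ; bound  = bound A + bound A
  ; finite = bounded }
  where
  bounded : ∀ x → bound A + bound A ≤ x → (mem A x ∨ mem (copy A) x) ≡ false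
  bounded x l rewrite finite A x (≤-trans (m≤m+n (bound A) (bound A)) l) =
    finite (copy A) x l

copyObj : {r : ℕ} → Obj r → Obj r
copyObj Ω i = copy (Ω i)

copyObj-bij : {r : ℕ} (Ω : Obj r) → Bij Ω (copyObj Ω)
copyObj-bij Ω = mkBij (λ i → copy↔ (Ω i))

withCopy-disjUnion : {r : ℕ} (Ω : Obj r) → IsDisjUnion Ω (copyObj Ω) (λ i → withCopy (Ω i))
withCopy-disjUnion Ω = record
  { disjoint = λ i → copy-disjoint (Ω i)
  ; union    = λ i x → refl }

module CompositionOperator {r : ℕ} (S : Species r) (η : EtaType S)
                           (C : IsCompositionOperator S η) where
  open IsCompositionOperator C

  ∅∐∅ : IsDisjUnion (∅obj r) (∅obj r) (∅obj r)
  ∅∐∅ = record { disjoint = λ _ _ → refl ; union = λ _ _ → refl }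

  η∅-injective : JointlyInjective (η ∅∐∅)
  η∅-injective = injective ∅∐∅

  -- (D1) for a decomposition against itself: Ω₁ ∩ Ω₂ = Ω₂ ∩ Ω₁ = ∅, so any
  -- value η(a, b) factors as η(η(a₁, e), η(e', b₂)) with e ∈ F[∅].
  value⇒F∅ : {Ω₁ Ω₂ Ω : Obj r} → IsDisjUnion Ω₁ Ω₂ Ω →
    F S Ω₁ → F S Ω₂ → F S (∅obj r)
  value⇒F∅ {Ω₁} {Ω₂} d a b =
    proj₁ (proj₂ (proj₁ (D1 d d Ω₁∩Ω₁ Ω₁∩Ω₂ Ω₂∩Ω₁ Ω₂∩Ω₂ Ω₁∐∅ ∅∐Ω₂ (η d a b))
                         ((a , b , refl) , (a , b , refl))))
    where
    open IsDisjUnion d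
    Ω₁∩Ω₁ : IsInter Ω₁ Ω₁ Ω₁
    Ω₁∩Ω₁ i x = sym (∧-idem _)
    Ω₁∩Ω₂ : IsInter Ω₁ Ω₂ (∅obj r)
    Ω₁∩Ω₂ i x = sym (disjoint i x)
    Ω₂∩Ω₁ : IsInter Ω₂ Ω₁ (∅obj r)
    Ω₂∩Ω₁ i x = sym (trans (∧-comm (mem (Ω₂ i) x) _) (disjoint i x))
    Ω₂∩Ω₂ : IsInter Ω₂ Ω₂ Ω₂
    Ω₂∩Ω₂ i x = sym (∧-idem _)
    Ω₁∐∅ : IsDisjUnion Ω₁ (∅obj r) Ω₁
    Ω₁∐∅ = record { disjoint = λ i x → ∧-zeroʳ _ ; union = λ i x → sym (∨-identityʳ _) }
    ∅∐Ω₂ : IsDisjUnion (∅obj r) Ω₂ Ω₂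
    ∅∐Ω₂ = record { disjoint = λ i x → refl ; union = λ i x → refl }

  -- If F is nonempty on some Ω, pair an element with its transport to a
  -- disjoint copy of Ω to obtain a value of η.
  F∅-inhabited : Σ (Obj r) (F S) → F S (∅obj r)
  F∅-inhabited (Ω , z) =
    value⇒F∅ (withCopy-disjUnion Ω) z (F-map S (copyObj-bij Ω) z)

lemma3p1 : (r : ℕ) → .{{_ : NonZero r}} → (S : Species r) → (η : EtaType S) →
    IsCompositionOperator S η → Σ (Obj r) (λ Ω → F S Ω) →
    F S (∅obj r) ↔ Fin 1
lemma3p1 r S η C nonempty =
  inhabited-subsingleton↔Fin1 (F∅-inhabited nonempty)
    (finite-injective-op⇒subsingleton (F-fin S (∅obj r)) (η ∅∐∅) η∅-injective)
  where open CompositionOperator S η C
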